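{- Let $T$ be an $s$-Tamari tree, let $1\le a<b\le n$ be such that $(a,b)$ is a Tamari tree ascent of $T$, and let $Z$ be the $s$-Tamari rotation of $T$ along $(a,b)$. Then $(f,e)\in A^{Tam}_T(a,b)$ if and only if $f=b$ and $e\in T^a\setminus 0$, in which case $\#_Z(f,e)=\#_T(f,e)+1$.
   Context: $s=(s(1),\dots,s(n))$ is a sequence of nonnegative integers. An $s$-decreasing tree is a planar rooted tree $T$ whose internal vertices are labeled bijectively by $1,\dots,n$ (leaves unlabeled), such that vertex $i$ has exactly $s(i)+1$ children indexed $0,\dots,s(i)$ from left to right, and every labeled descendant of $i$ has smaller label. $T^i$ is the full subtree rooted at $i$, $T^i_j$ that rooted at the $j$-th child of $i$, and $T^i\setminus 0$ is $T^i$ with $T^i_0$ replaced by a leaf. For $x<y$, $\#_T(y,x)$ is $0$ if $x$ is left of $y$ or $x\in T^y_0$; $i$ if $x\in T^y_i$ with $0<i<s(y)$; $s(y)$ if $x\in T^y_{s(y)}$ or $x$ is right of $y$. $\mathrm{inv}(T)$ is the multiset of pairs $(y,x)$ with multiplicity $\#_T(y,x)$. For such multisets, $I+(b,a)$ increases the multiplicity of $(b,a)$ by one (capped at $s(b)$); $I$ is transitive if for all $a<b<c$ with $\#_I(c,b)=i$, either $\#_I(b,a)=0$ or $\#_I(c,a)\ge i$; $I^{tc}$ is the smallest transitive multiset containing $I$. An $s$-Tamari tree is an $s$-decreasing tree with $\#_T(c,a)\le\#_T(c,b)$ for all $a<b<c$. For $a<b$, $(a,b)$ is a Tamari tree ascent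 of $T$ if $a$ is a child of $b$ and $\#_T(b,a)<s(b)$; the $s$-Tamari rotation along it is the unique $s$-Tamari tree $Z$ with $\mathrm{inv}(Z)=(\mathrm{inv}(T)+(b,a))^{tc}$. $A^{Tam}_T(a,b)=\{(f,e):\#_Z(f,e)>\#_T(f,e)\}$. -}

module Defs where

open import Data.Nat using (ℕ; zero; suc; _≤_; _<_; _⊔_; _⊓_; _≟_; _<?_)
open import Data.List using (List; []; _∷_; _++_; length; map; upTo)
open import Data.List.Relation.Unary.All using (All)
open import Data.List.Relation.Binary.Permutation.Propositional using (_↭_)
open import Data.Maybe using (Maybe; just; nothing)
open import Data.Product using (Σ; _×_; _,_; ∃; ∃-syntax)
open import Data.Sum using (_⊎_)
open import Relation.Nullary using (yes; no)
open import Relation.Binary.PropositionalEquality using (_≡_)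

data Tree : Set where
  leaf : Tree
  node : ℕ → List Tree → Tree

mutual
  labels : Tree → List ℕ
  labels leaf        = []
  labels (node i ts) = i ∷ labelsF ts

  labelsF : List Tree → List ℕ
  labelsF []       = []
  labelsF (t ∷ ts) = labels t ++ labelsF ts

data Arity (s : ℕ → ℕ) : Tree → Set where
  leafA : Arity s leaf
  nodeA : ∀ {i ts} → length ts ≡ suc (s i) → All (Arity s) ts → Arity s (node i ts)

data Decreasing : Tree → Set where
  leafD : Decreasing leaf
  nodeD : ∀ {i ts} → All (λ x → x < i) (labelsF ts) → All Decreasing ts →
          Decreasing (node i ts)

-- s-decreasing tree for s = (s(1),…,s(n)); values of s outside 1..n are unused
record IsSDecTree (n : ℕ) (s : ℕ → ℕ) (T : Tree) : Set where
  field
    arity      : Arity s T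
    decreasing : Decreasing T
    bijective  : labels T ↭ map suc (upTo n)

-- Position of a label: the path of child indices from the root.

mutual
  find : ℕ → Tree → Maybe (List ℕ)
  find x leaf = nothing
  find x (node i ts) with x ≟ i
  ... | yes _ = just []
  ... | no  _ = findF x 0 ts

  findF : ℕ → ℕ → List Tree → Maybe (List ℕ)
  findF x k [] = nothing
  findF x k (t ∷ ts) with find x t
  ... | just p  = just (k ∷ p)
  ... | nothing = findF x (suc k) ts

-- Compare path q of y with path p of x (value of #(y,x), sy = s(y)):
--  * p = q ++ (i ∷ _) : x ∈ T^y_i, value i (i = 0 gives 0, i = s(y) gives s(y));
--  * first divergence with x's index smaller: x left of y, value 0;
--  * first divergence with x's index larger: x right of y, value s(y).
cmpPath : ℕ → List ℕ → List ℕ → ℕ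
cmpPath sy []      []      = 0
cmpPath sy []      (i ∷ p) = i
cmpPath sy (j ∷ q) []      = 0      -- x ancestor of y: impossible when x < y
cmpPath sy (j ∷ q) (i ∷ p) with i ≟ j
... | yes _ = cmpPath sy q p
... | no  _ with i <? j
...   | yes _ = 0
...   | no  _ = sy

-- #_T(y,x)  (meaningful for 1 ≤ x < y ≤ n)
#_ : (s : ℕ → ℕ) → Tree → ℕ → ℕ → ℕ
#_ s T y x with find y T | find x T
... | just q | just p = cmpPath (s y) q p
... | _      | _      = 0

-- Multisets of pairs (y,x), 1 ≤ x < y ≤ n: multiplicity functions.

Multiset : Set
Multiset = ℕ → ℕ → ℕ

inv : (s : ℕ → ℕ) → Tree → Multiset
inv s T y x = (# s) T y x

addPair : (s : ℕ → ℕ) → Multiset → ℕ → ℕ → Multiset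
addPair s I b a y x with y ≟ b | x ≟ a
... | yes _ | yes _ = suc (I b a) ⊓ s b
... | _     | _     = I y x

Transitive : ℕ → Multiset → Set
Transitive n I = ∀ a b c → 1 ≤ a → a < b → b < c → c ≤ n →
                 I b a ≡ 0 ⊎ I c b ≤ I c a

Contained : ℕ → Multiset → Multiset → Set
Contained n I J = ∀ x y → 1 ≤ x → x < y → y ≤ n → I y x ≤ J y x

IsTC : ℕ → Multiset → Multiset → Set
IsTC n I J = Contained n I J × Transitive n J ×
             ((K : Multiset) → Contained n I K → Transitive n K → Contained n J K)

record IsSTamari (n : ℕ) (s : ℕ → ℕ) (T : Tree) : Set where
  field
    sdec   : IsSDecTree n s T
    tamari : ∀ a b c → 1 ≤ a → a < b → b < c → c ≤ n →
             (# s) T c a ≤ (# s) T c b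

IsChild : Tree → ℕ → ℕ → Set
IsChild T a b = ∃[ q ] ∃[ i ] (find b T ≡ just q × find a T ≡ just (q ++ i ∷ []))

TamariAscent : (s : ℕ → ℕ) → Tree → ℕ → ℕ → Set
TamariAscent s T a b = a < b × IsChild T a b × (# s) T b a < s b

-- e is a labelled vertex of T^a ∖ 0 (T^a with T^a_0 replaced by a leaf)
InSubtreeMinus0 : Tree → ℕ → ℕ → Set
InSubtreeMinus0 T a e =
  ∃[ q ] ∃[ r ] (find a T ≡ just q × find e T ≡ just (q ++ r) ×
                 (r ≡ [] ⊎ ∃[ i ] ∃[ r' ] (r ≡ suc i ∷ r')))

-- Write I = inv T and i = #_T(b,a), the index of a among the children of b. Raise the row b of I
-- to max(#(b,x), i+1) for x ∈ T^a ∖ 0 and call the result Iᵗᶜ. It contains I + (b,a) and is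
-- transitive, since I is and a's path extends b's (so #(z,b) ≤ #(z,a) for all z); conversely, a
-- transitive multiset containing I + (b,a), where #(b,a) ≥ i+1, must raise all of T^a ∖ 0 along
-- with a. Hence inv Z = Iᵗᶜ, which differs from I exactly at the pairs (b,e), e ∈ T^a ∖ 0, where
-- #_T(b,e) = i.

module Submission where

open import Defs
open import Data.Nat using (ℕ; zero; suc; _+_; _≤_; _<_; _⊔_; _⊓_; _≟_; _<?_; z≤n; z<s)
open import Data.Nat.Properties
open import Data.List using (List; []; _∷_; _++_; length)
open import Data.List.Properties using (++-assoc; ++-identityʳ; ++-conicalʳ)
open import Data.List.Relation.Unary.All using (All; _∷_)
open import Data.List.Relation.Unary.All.Properties using (++⁻ˡ; ++⁻ʳ)
open import Data.Maybe using (just; nothing)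
open import Data.Maybe.Properties using (just-injective)
open import Data.Product using (_×_; _,_; proj₁; proj₂; ∃-syntax)
open import Data.Sum using (_⊎_; inj₁; inj₂; map₁; map₂)
open import Data.Empty using (⊥-elim)
open import Function using (_∘_)
open import Function.Bundles using (_⇔_; mk⇔)
open import Relation.Binary using (tri<; tri≈; tri>)
open import Relation.Binary.PropositionalEquality
  using (_≡_; refl; sym; trans; cong; subst; subst₂; module ≡-Reasoning)
open import Relation.Nullary using (Dec; yes; no; ¬_; contradiction)
open import Relation.Nullary.Decidable using (_×-dec_; _⊎-dec_)

cmpPath-here : ∀ sy j q p → cmpPath sy (j ∷ q) (j ∷ p) ≡ cmpPath sy q p
cmpPath-here sy j q p with j ≟ j
... | yes _ = refl
... | no j≢j = contradiction refl j≢j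

cmpPath-left : ∀ sy {j i} q p → i < j → cmpPath sy (j ∷ q) (i ∷ p) ≡ 0
cmpPath-left sy {j} {i} q p i<j with i ≟ j
... | yes i≡j = contradiction i≡j (<⇒≢ i<j)
... | no _ with i <? j
...   | yes _ = refl
...   | no i≮j = contradiction i<j i≮j

cmpPath-right : ∀ sy {j i} q p → j < i → cmpPath sy (j ∷ q) (i ∷ p) ≡ sy
cmpPath-right sy {j} {i} q p j<i with i ≟ j
... | yes i≡j = contradiction (sym i≡j) (<⇒≢ j<i)
... | no _ with i <? j
...   | yes i<j = contradiction i<j (<⇒≯ j<i)
...   | no _ = refl

cmpPath-extension : ∀ sy q m r → cmpPath sy q (q ++ m ∷ r) ≡ m
cmpPath-extension sy []      m r = refl
cmpPath-extension sy (j ∷ q) m r = trans (cmpPath-here sy j q (q ++ m ∷ r)) (cmpPath-extension sy q m r)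

cmpPath-mono-++ : ∀ sy q p r → cmpPath sy q p ≤ cmpPath sy q (p ++ r)
cmpPath-mono-++ sy []      []      r = z≤n
cmpPath-mono-++ sy []      (k ∷ p) r = ≤-refl
cmpPath-mono-++ sy (j ∷ q) []      r = z≤n
cmpPath-mono-++ sy (j ∷ q) (k ∷ p) r with <-cmp k j
... | tri< k<j _ _ rewrite cmpPath-left sy q p k<j | cmpPath-left sy q (p ++ r) k<j = z≤n
... | tri≈ _ refl _ rewrite cmpPath-here sy k q p | cmpPath-here sy k q (p ++ r) = cmpPath-mono-++ sy q p r
... | tri> _ _ j<k rewrite cmpPath-right sy q p j<k | cmpPath-right sy q (p ++ r) j<k = ≤-refl

BranchIndex≤ : ℕ → List ℕ → List ℕ → Set
BranchIndex≤ sy q p = ∀ j r → p ≡ q ++ j ∷ r → j ≤ sy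

BranchIndex≤-∷ : ∀ {sy j q p} → BranchIndex≤ sy (j ∷ q) (j ∷ p) → BranchIndex≤ sy q p
BranchIndex≤-∷ {j = j} branch≤ k r p≡ = branch≤ k r (cong (j ∷_) p≡)

cmpPath-≤ : ∀ sy q p → BranchIndex≤ sy q p → cmpPath sy q p ≤ sy
cmpPath-≤ sy []      []      branch≤ = z≤n
cmpPath-≤ sy []      (k ∷ p) branch≤ = branch≤ k p refl
cmpPath-≤ sy (j ∷ q) []      branch≤ = z≤n
cmpPath-≤ sy (j ∷ q) (k ∷ p) branch≤ with <-cmp k j
... | tri< k<j _ _ rewrite cmpPath-left sy q p k<j = z≤n
... | tri≈ _ refl _ rewrite cmpPath-here sy k q p = cmpPath-≤ sy q p (BranchIndex≤-∷ branch≤)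
... | tri> _ _ j<k rewrite cmpPath-right sy q p j<k = ≤-refl

cmpPath-transitive : ∀ sb sc pc pb pa → BranchIndex≤ sc pc pb →
                     cmpPath sb pb pa ≡ 0 ⊎ cmpPath sc pc pb ≤ cmpPath sc pc pa
cmpPath-transitive sb sc []       []       pa       branch≤ = inj₂ z≤n
cmpPath-transitive sb sc pc       (k ∷ pb) []       branch≤ = inj₁ refl
cmpPath-transitive sb sc []       (k ∷ pb) (l ∷ pa) branch≤ with <-cmp l k
... | tri< l<k _ _ = inj₁ (cmpPath-left sb pb pa l<k)
... | tri≈ _ refl _ = inj₂ ≤-refl
... | tri> _ _ k<l = inj₂ (<⇒≤ k<l)
cmpPath-transitive sb sc (j ∷ pc) []       pa       branch≤ = inj₂ z≤n
cmpPath-transitive sb sc (j ∷ pc) (k ∷ pb) (l ∷ pa) branch≤ with <-cmp k j | <-cmp l k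
... | tri< k<j _ _ | _ rewrite cmpPath-left sc pc pb k<j = inj₂ z≤n
... | _            | tri< l<k _ _ = inj₁ (cmpPath-left sb pb pa l<k)
... | tri≈ _ refl _ | tri≈ _ refl _
  rewrite cmpPath-here sb l pb pa | cmpPath-here sc l pc pb | cmpPath-here sc l pc pa =
  cmpPath-transitive sb sc pc pb pa (BranchIndex≤-∷ branch≤)
... | tri≈ _ refl _ | tri> _ _ k<l
  rewrite cmpPath-here sc k pc pb | cmpPath-right sc pc pa k<l =
  inj₂ (cmpPath-≤ sc pc pb (BranchIndex≤-∷ branch≤))
... | tri> _ _ j<k | tri≈ _ refl _
  rewrite cmpPath-right sc pc pb j<k | cmpPath-right sc pc pa j<k = inj₂ ≤-refl
... | tri> _ _ j<k | tri> _ _ k<l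
  rewrite cmpPath-right sc pc pb j<k | cmpPath-right sc pc pa (<-trans j<k k<l) = inj₂ ≤-refl

cmpPath-positive-branch : ∀ sa sb i q p → i < sb → 0 < cmpPath sa (q ++ i ∷ []) p → cmpPath sb q p ≤ i →
                          ∃[ k ] ∃[ r ] p ≡ (q ++ i ∷ []) ++ suc k ∷ r
cmpPath-positive-branch sa sb i []      []      i<sb () p≤i
cmpPath-positive-branch sa sb i (j ∷ q) []      i<sb () p≤i
cmpPath-positive-branch sa sb i []      (l ∷ p) i<sb pos l≤i with <-cmp l i
... | tri< l<i _ _ = contradiction (subst (0 <_) (cmpPath-left sa [] p l<i) pos) n≮0
... | tri> _ _ i<l = contradiction l≤i (<⇒≱ i<l)
cmpPath-positive-branch sa sb i []      (l ∷ p) i<sb pos l≤i | tri≈ _ refl _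
  rewrite cmpPath-here sa l [] p with p | pos
... | suc k ∷ r | _  = k , r , refl
... | zero ∷ r  | ()
... | []        | ()
cmpPath-positive-branch sa sb i (j ∷ q) (l ∷ p) i<sb pos p≤i with <-cmp l j
... | tri< l<j _ _ = contradiction (subst (0 <_) (cmpPath-left sa (q ++ i ∷ []) p l<j) pos) n≮0
... | tri> _ _ j<l = contradiction (subst (_≤ i) (cmpPath-right sb q p j<l) p≤i) (<⇒≱ i<sb)
... | tri≈ _ refl _ rewrite cmpPath-here sa l (q ++ i ∷ []) p | cmpPath-here sb l q p
  with cmpPath-positive-branch sa sb i q p i<sb pos p≤i
...   | k , r , p≡ = k , r , cong (l ∷_) p≡

findF-head-≥ : ∀ x m ts {k p} → findF x m ts ≡ just (k ∷ p) → m ≤ k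
findF-head-≥ x m []       ()
findF-head-≥ x m (t ∷ ts) h with find x t
findF-head-≥ x m (t ∷ ts) refl | just _ = ≤-refl
... | nothing = <⇒≤ (findF-head-≥ x (suc m) ts h)

findF-head-< : ∀ x m ts {k p} → findF x m ts ≡ just (k ∷ p) → k < m + length ts
findF-head-< x m []       ()
findF-head-< x m (t ∷ ts) h with find x t
findF-head-< x m (t ∷ ts) refl | just _ = m<m+n m z<s
... | nothing rewrite +-suc m (length ts) = findF-head-< x (suc m) ts h

findF≢just[] : ∀ x m ts → ¬ findF x m ts ≡ just []
findF≢just[] x m []       ()
findF≢just[] x m (t ∷ ts) h with find x t
findF≢just[] x m (t ∷ ts) () | just _
... | nothing = findF≢just[] x (suc m) ts h

mutual
  All-find : ∀ {P : ℕ → Set} x t {p} → All P (labels t) → find x t ≡ just p → P x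
  All-find x leaf        _          ()
  All-find x (node i ts) (Pi ∷ Pts) h with x ≟ i
  ... | yes refl = Pi
  ... | no _     = All-findF x 0 ts Pts h

  All-findF : ∀ {P : ℕ → Set} x m ts {p} → All P (labelsF ts) → findF x m ts ≡ just p → P x
  All-findF x m []       _   ()
  All-findF x m (t ∷ ts) Pts h with find x t in fx
  ... | just _  = All-find x t (++⁻ˡ (labels t) Pts) fx
  ... | nothing = All-findF x (suc m) ts (++⁻ʳ (labels t) Pts) h

mutual
  find-injective : ∀ x y t {p} → find x t ≡ just p → find y t ≡ just p → x ≡ y
  find-injective x y leaf () _
  find-injective x y (node i ts) fx fy with x ≟ i | y ≟ i
  ... | yes refl | yes refl = refl
  find-injective x y (node i ts) refl fy | yes _ | no _ = ⊥-elim (findF≢just[] y 0 ts fy)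
  find-injective x y (node i ts) fx refl | no _  | yes _ = ⊥-elim (findF≢just[] x 0 ts fx)
  ... | no _ | no _ = findF-injective x y 0 ts fx fy

  findF-injective : ∀ x y m ts {p} → findF x m ts ≡ just p → findF y m ts ≡ just p → x ≡ y
  findF-injective x y m []       () _
  findF-injective x y m (t ∷ ts) fx fy with find x t in ex | find y t in ey
  findF-injective x y m (t ∷ ts) refl refl | just p | just .p = find-injective x y t ex ey
  findF-injective x y m (t ∷ ts) refl fy   | just _ | nothing = ⊥-elim (1+n≰n (findF-head-≥ y (suc m) ts fy))
  findF-injective x y m (t ∷ ts) fx   refl | nothing | just _ = ⊥-elim (1+n≰n (findF-head-≥ x (suc m) ts fx))
  ... | nothing | nothing = findF-injective x y (suc m) ts fx fy

mutual
  find-descendant : ∀ s x y t {p j r} → Decreasing t → Arity s t →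
                    find x t ≡ just p → find y t ≡ just (p ++ j ∷ r) → y < x × j ≤ s x
  find-descendant s x y leaf _ _ () _
  find-descendant s x y (node i ts) {p} {j} {r} (nodeD below dts) (nodeA len ats) fx fy with x ≟ i | y ≟ i
  find-descendant s x y (node i ts) _ _ refl () | yes refl | yes _
  find-descendant s x y (node i ts) (nodeD below _) (nodeA len _) refl fy | yes refl | no _ =
    All-findF y 0 ts below fy , ≤-pred (subst (_ <_) len (findF-head-< y 0 ts fy))
  ... | no _ | yes _ = contradiction (++-conicalʳ p (j ∷ r) (sym (just-injective fy))) λ ()
  ... | no _ | no _  = findF-descendant s x y 0 ts dts ats fx fy

  findF-descendant : ∀ s x y m ts {p j r} → All Decreasing ts → All (Arity s) ts →
                     findF x m ts ≡ just p → findF y m ts ≡ just (p ++ j ∷ r) → y < x × j ≤ s x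
  findF-descendant s x y m []       _          _          () _
  findF-descendant s x y m (t ∷ ts) (dt ∷ dts) (at ∷ ats) fx fy with find x t in ex | find y t in ey
  findF-descendant s x y m (t ∷ ts) (dt ∷ dts) (at ∷ ats) refl refl | just _ | just _ =
    find-descendant s x y t dt at ex ey
  findF-descendant s x y m (t ∷ ts) _ _ refl fy | just _ | nothing =
    ⊥-elim (1+n≰n (findF-head-≥ y (suc m) ts fy))
  findF-descendant s x y m (t ∷ ts) {p} _ _ fx fy | nothing | just _ =
    ⊥-elim (later-head p fx (just-injective fy))
    where
    later-head : ∀ p {u v} → findF x (suc m) ts ≡ just p → ¬ m ∷ v ≡ p ++ u
    later-head []      fx′ _    = findF≢just[] x (suc m) ts fx′
    later-head (k ∷ p) fx′ refl = 1+n≰n (findF-head-≥ x (suc m) ts fx′)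
  ... | nothing | nothing = findF-descendant s x y (suc m) ts dts ats fx fy

#-found : ∀ s T y x {q p} → find y T ≡ just q → find x T ≡ just p → (# s) T y x ≡ cmpPath (s y) q p
#-found s T y x fy fx rewrite fy | fx = refl

#-unfound : ∀ s T y x {q} → find y T ≡ just q → find x T ≡ nothing → (# s) T y x ≡ 0
#-unfound s T y x fy fx rewrite fy | fx = refl

#-transitive : ∀ s T → Decreasing T → Arity s T → ∀ x y z →
               (# s) T y x ≡ 0 ⊎ (# s) T z y ≤ (# s) T z x
#-transitive s T dec ar x y z with find z T in fz | find y T in fy | find x T in fx
... | just pz | just py | just px = cmpPath-transitive (s y) (s z) pz py px
    (λ j r py≡ → proj₂ (find-descendant s z y T dec ar fz (trans fy (cong just py≡))))
... | nothing | _       | _       = inj₂ z≤n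
... | just _  | nothing | _       = inj₂ z≤n
... | just _  | just _  | nothing = inj₁ refl

m<m⊔n⇒m<n : ∀ {m n} → m < m ⊔ n → m < n
m<m⊔n⇒m<n {m} {n} m<m⊔n with m <? n
... | yes m<n = m<n
... | no m≮n = contradiction (subst (m <_) (m≥n⇒m⊔n≡m (≮⇒≥ m≮n)) m<m⊔n) (n≮n m)

addPair-here : ∀ s I b a → addPair s I b a b a ≡ suc (I b a) ⊓ s b
addPair-here s I b a with b ≟ b | a ≟ a
... | yes _ | yes _ = refl
... | no b≢b | _    = contradiction refl b≢b
... | yes _ | no a≢a = contradiction refl a≢a

addPair-elsewhere : ∀ s I b a y x → ¬ (y ≡ b × x ≡ a) → addPair s I b a y x ≡ I y x
addPair-elsewhere s I b a y x ≢ba with y ≟ b | x ≟ a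
... | yes y≡b | yes x≡a = contradiction (y≡b , x≡a) ≢ba
... | yes _   | no _    = refl
... | no _    | yes _   = refl
... | no _    | no _    = refl

module Ascent {s : ℕ → ℕ} {T : Tree} (dec : Decreasing T) (ar : Arity s T)
              {a b : ℕ} (a<b : a < b) {q : List ℕ} {i₀ : ℕ}
              (find-b : find b T ≡ just q) (find-a : find a T ≡ just (q ++ i₀ ∷ []))
              (ascent : (# s) T b a < s b) where

  I : Multiset
  I = inv s T

  i : ℕ
  i = I b a

  i≡i₀ : i ≡ i₀
  i≡i₀ = trans (#-found s T b a find-b find-a) (cmpPath-extension (s b) q i₀ [])

  -- Besides T^a ∖ 0 this holds for the x < a right of a, where already #(b,x) > i.
  Bumped : ℕ → Set
  Bumped x = x ≡ a ⊎ (x < a × 0 < I a x)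

  Bumped? : ∀ x → Dec (Bumped x)
  Bumped? x = (x ≟ a) ⊎-dec ((x <? a) ×-dec (0 <? I a x))

  Iᵗᶜ : Multiset
  Iᵗᶜ y x with (y ≟ b) ×-dec Bumped? x
  ... | yes _ = I y x ⊔ suc i
  ... | no _  = I y x

  Iᵗᶜ-bumped : ∀ {x} → Bumped x → Iᵗᶜ b x ≡ I b x ⊔ suc i
  Iᵗᶜ-bumped {x} bx with (b ≟ b) ×-dec Bumped? x
  ... | yes _ = refl
  ... | no ¬raised = contradiction (refl , bx) ¬raised

  Iᵗᶜ-unbumped : ∀ {y x} → ¬ (y ≡ b × Bumped x) → Iᵗᶜ y x ≡ I y x
  Iᵗᶜ-unbumped {y} {x} ¬raised with (y ≟ b) ×-dec Bumped? x
  ... | yes raised = contradiction raised ¬raised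
  ... | no _ = refl

  I≤Iᵗᶜ : ∀ y x → I y x ≤ Iᵗᶜ y x
  I≤Iᵗᶜ y x with (y ≟ b) ×-dec Bumped? x
  ... | yes _ = m≤m⊔n _ _
  ... | no _  = ≤-refl

  I≤addPair : ∀ y x → I y x ≤ addPair s I b a y x
  I≤addPair y x with (y ≟ b) ×-dec (x ≟ a)
  ... | yes (refl , refl) rewrite addPair-here s I b a = ⊓-glb (n≤1+n i) (<⇒≤ ascent)
  ... | no ≢ba rewrite addPair-elsewhere s I b a y x ≢ba = ≤-refl

  I-transitive : ∀ x y z → I y x ≡ 0 ⊎ I z y ≤ I z x
  I-transitive = #-transitive s T dec ar

  I-parent≤child : ∀ z → I z b ≤ I z a
  I-parent≤child z with find z T in find-z
  ... | nothing = z≤n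
  ... | just pz rewrite find-b | find-a = cmpPath-mono-++ (s z) pz q (i₀ ∷ [])

  I-parent≤bumped : ∀ z {x} → Bumped x → I z b ≤ I z x
  I-parent≤bumped z (inj₁ refl) = I-parent≤child z
  I-parent≤bumped z {x} (inj₂ (x<a , pos)) with I-transitive x a z
  ... | inj₁ I≡0 = contradiction I≡0 (n>0⇒n≢0 pos)
  ... | inj₂ le   = ≤-trans (I-parent≤child z) le

  Bumped-downward : ∀ {x y} → x < y → 0 < I y x → Bumped y → Bumped x
  Bumped-downward x<a pos (inj₁ refl) = inj₂ (x<a , pos)
  Bumped-downward {x} {y} x<y pos (inj₂ (y<a , pos′)) with I-transitive x y a
  ... | inj₁ I≡0 = contradiction I≡0 (n>0⇒n≢0 pos)
  ... | inj₂ le   = inj₂ (<-trans x<y y<a , <-≤-trans pos′ le)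

  Iᵗᶜ-transitive-row-b : ∀ {x y} → x < y → y < b → Iᵗᶜ y x ≡ 0 ⊎ Iᵗᶜ b y ≤ Iᵗᶜ b x
  Iᵗᶜ-transitive-row-b {x} {y} x<y y<b with I y x ≟ 0
  ... | yes I≡0 = inj₁ (trans (Iᵗᶜ-unbumped (λ (y≡b , _) → <⇒≢ y<b y≡b)) I≡0)
  ... | no I≢0 with I-transitive x y b
  ...   | inj₁ I≡0 = contradiction I≡0 I≢0
  ...   | inj₂ le  = inj₂ (raise (Bumped? y) (Bumped? x))
    where
    raise : Dec (Bumped y) → Dec (Bumped x) → Iᵗᶜ b y ≤ Iᵗᶜ b x
    raise (no ¬by) _ = begin
      Iᵗᶜ b y ≡⟨ Iᵗᶜ-unbumped (¬by ∘ proj₂) ⟩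
      I b y   ≤⟨ le ⟩
      I b x   ≤⟨ I≤Iᵗᶜ b x ⟩
      Iᵗᶜ b x ∎
      where open ≤-Reasoning
    raise (yes by) (yes bx) =
      subst₂ _≤_ (sym (Iᵗᶜ-bumped by)) (sym (Iᵗᶜ-bumped bx)) (⊔-monoˡ-≤ (suc i) le)
    raise (yes by) (no ¬bx) = contradiction (Bumped-downward x<y (n≢0⇒n>0 I≢0) by) ¬bx

  Iᵗᶜ-I-transitive : ∀ {x y} z → Iᵗᶜ y x ≡ 0 ⊎ I z y ≤ I z x
  Iᵗᶜ-I-transitive {x} {y} z = by-cases (y ≟ b) (Bumped? x)
    where
    by-cases : Dec (y ≡ b) → Dec (Bumped x) → Iᵗᶜ y x ≡ 0 ⊎ I z y ≤ I z x
    by-cases (yes refl) (yes bx) = inj₂ (I-parent≤bumped z bx)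
    by-cases (yes refl) (no ¬bx) = map₁ (trans (Iᵗᶜ-unbumped (¬bx ∘ proj₂))) (I-transitive x b z)
    by-cases (no y≢b)   _        = map₁ (trans (Iᵗᶜ-unbumped (y≢b ∘ proj₁))) (I-transitive x y z)

  Iᵗᶜ-transitive : ∀ n → Transitive n Iᵗᶜ
  Iᵗᶜ-transitive n x y z _ x<y y<z _ = by-cases (z ≟ b)
    where
    by-cases : Dec (z ≡ b) → Iᵗᶜ y x ≡ 0 ⊎ Iᵗᶜ z y ≤ Iᵗᶜ z x
    by-cases (yes refl) = Iᵗᶜ-transitive-row-b x<y y<z
    by-cases (no z≢b)   = map₂ (subst₂ _≤_ (sym row-z) (sym row-z)) (Iᵗᶜ-I-transitive z)
      where
      row-z : ∀ {x} → Iᵗᶜ z x ≡ I z x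
      row-z = Iᵗᶜ-unbumped (z≢b ∘ proj₁)

  addPair⊆Iᵗᶜ : ∀ n → Contained n (addPair s I b a) Iᵗᶜ
  addPair⊆Iᵗᶜ n x y _ _ _ with (y ≟ b) ×-dec (x ≟ a)
  ... | yes (refl , refl) rewrite addPair-here s I b a | Iᵗᶜ-bumped (inj₁ refl) =
    ≤-trans (m⊓n≤m (suc i) (s b)) (m≤n⊔m i (suc i))
  ... | no ≢ba rewrite addPair-elsewhere s I b a y x ≢ba = I≤Iᵗᶜ y x

  addPair⊆⇒I⊆ : ∀ n K → Contained n (addPair s I b a) K → Contained n I K
  addPair⊆⇒I⊆ n K addPair⊆K x y 1≤x x<y y≤n = ≤-trans (I≤addPair y x) (addPair⊆K x y 1≤x x<y y≤n)

  Iᵗᶜ-least : ∀ n K → Contained n (addPair s I b a) K → Transitive n K → Contained n Iᵗᶜ K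
  Iᵗᶜ-least n K addPair⊆K K-transitive x y 1≤x x<y y≤n with (y ≟ b) ×-dec Bumped? x
  ... | no _            = addPair⊆⇒I⊆ n K addPair⊆K x y 1≤x x<y y≤n
  ... | yes (refl , bx) = ⊔-lub (addPair⊆⇒I⊆ n K addPair⊆K x b 1≤x x<y y≤n) (raised bx)
    where
    suc-i≤K : 1 ≤ a → suc i ≤ K b a
    suc-i≤K 1≤a = subst (_≤ K b a) (trans (addPair-here s I b a) (m≤n⇒m⊓n≡m ascent))
                        (addPair⊆K a b 1≤a a<b y≤n)

    raised : Bumped x → suc i ≤ K b x
    raised (inj₁ refl) = suc-i≤K 1≤x
    raised (inj₂ (x<a , pos)) with K-transitive x a b 1≤x x<a a<b y≤n
    ... | inj₁ K≡0 = contradiction K≡0 (n>0⇒n≢0 (<-≤-trans pos I≤K))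
      where
      I≤K : I a x ≤ K a x
      I≤K = addPair⊆⇒I⊆ n K addPair⊆K x a 1≤x x<a (≤-trans (<⇒≤ a<b) y≤n)
    ... | inj₂ le  = ≤-trans (suc-i≤K (≤-trans 1≤x (<⇒≤ x<a))) le

  subtree⇒Bumped : ∀ {x} → InSubtreeMinus0 T a x → Bumped x × I b x ≡ i
  subtree⇒Bumped {x} (qa , r , find-a′ , find-x , shape) with trans (sym find-a′) find-a
  ... | refl = bumped shape , I-b≡i
    where
    I-b≡i : I b x ≡ i
    I-b≡i = begin
      I b x                                        ≡⟨ #-found s T b x find-b find-x ⟩
      cmpPath (s b) q ((q ++ i₀ ∷ []) ++ r)        ≡⟨ cong (cmpPath (s b) q) (++-assoc q (i₀ ∷ []) r) ⟩
      cmpPath (s b) q (q ++ i₀ ∷ r)                ≡⟨ cmpPath-extension (s b) q i₀ r ⟩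
      i₀                                           ≡⟨ sym i≡i₀ ⟩
      i                                            ∎
      where open ≡-Reasoning

    bumped : r ≡ [] ⊎ ∃[ k ] ∃[ r′ ] r ≡ suc k ∷ r′ → Bumped x
    bumped (inj₁ refl) = inj₁ (find-injective x a T (trans find-x (cong just (++-identityʳ _))) find-a)
    bumped (inj₂ (k , r′ , refl)) =
      inj₂ ( proj₁ (find-descendant s a x T dec ar find-a find-x)
           , subst (0 <_) (sym (trans (#-found s T a x find-a find-x)
                                      (cmpPath-extension (s a) (q ++ i₀ ∷ []) (suc k) r′))) z<s )

  Bumped⇒subtree : ∀ {x} → Bumped x → I b x ≤ i → InSubtreeMinus0 T a x
  Bumped⇒subtree (inj₁ refl) _ =
    (q ++ i₀ ∷ []) , [] , find-a , trans find-a (cong just (sym (++-identityʳ _))) , inj₁ refl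
  Bumped⇒subtree {x} (inj₂ (x<a , pos)) I≤i = located (find x T) refl
    where
    located : ∀ m → find x T ≡ m → InSubtreeMinus0 T a x
    located nothing find-x = contradiction (#-unfound s T a x find-a find-x) (n>0⇒n≢0 pos)
    located (just px) find-x
      with cmpPath-positive-branch (s a) (s b) i₀ q px (subst (_< s b) i≡i₀ ascent)
             (subst (0 <_) (#-found s T a x find-a find-x) pos)
             (subst₂ _≤_ (#-found s T b x find-b find-x) i≡i₀ I≤i)
    ... | k , r , refl = (q ++ i₀ ∷ []) , suc k ∷ r , find-a , find-x , inj₂ (k , r , refl)

  Iᵗᶜ-subtree : ∀ {x} → InSubtreeMinus0 T a x → Iᵗᶜ b x ≡ suc (I b x)
  Iᵗᶜ-subtree {x} sub with subtree⇒Bumped sub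
  ... | bx , I-b≡i = begin
    Iᵗᶜ b x        ≡⟨ Iᵗᶜ-bumped bx ⟩
    I b x ⊔ suc i  ≡⟨ m≤n⇒m⊔n≡n (≤-trans (≤-reflexive I-b≡i) (n≤1+n i)) ⟩
    suc i          ≡⟨ cong suc (sym I-b≡i) ⟩
    suc (I b x)    ∎
    where open ≡-Reasoning

  Iᵗᶜ-raises⇔ : ∀ y x → I y x < Iᵗᶜ y x ⇔ (y ≡ b × InSubtreeMinus0 T a x)
  Iᵗᶜ-raises⇔ y x = mk⇔ (raised (y ≟ b) (Bumped? x))
                        λ { (refl , sub) → subst (I b x <_) (sym (Iᵗᶜ-subtree sub)) (n<1+n _) }
    where
    raised : Dec (y ≡ b) → Dec (Bumped x) → I y x < Iᵗᶜ y x → y ≡ b × InSubtreeMinus0 T a x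
    raised (yes refl) (yes bx) lt =
      refl , Bumped⇒subtree bx (≤-pred (m<m⊔n⇒m<n (subst (I b x <_) (Iᵗᶜ-bumped bx) lt)))
    raised (yes refl) (no ¬bx) lt = contradiction (subst (I b x <_) (Iᵗᶜ-unbumped (¬bx ∘ proj₂)) lt) (n≮n _)
    raised (no y≢b)   _        lt = contradiction (subst (I y x <_) (Iᵗᶜ-unbumped (y≢b ∘ proj₁)) lt) (n≮n _)

proposition4p5 : (n : ℕ) (s : ℕ → ℕ) (T Z : Tree) →
    IsSTamari n s T → IsSTamari n s Z →
    (a b : ℕ) → 1 ≤ a → a < b → b ≤ n →
    TamariAscent s T a b →
    IsTC n (addPair s (inv s T) b a) (inv s Z) →
    (e f : ℕ) → 1 ≤ e → e < f → f ≤ n →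
    ((# s) T f e < (# s) Z f e ⇔ (f ≡ b × InSubtreeMinus0 T a e)) ×
    (f ≡ b → InSubtreeMinus0 T a e → (# s) Z f e ≡ suc ((# s) T f e))
proposition4p5 n s T Z T-tamari _ a b _ a<b _ (_ , (q , i₀ , find-b , find-a) , ascent)
  (addPair⊆Z , Z-transitive , Z-least) e f 1≤e e<f f≤n
  = subst Claim (sym Z≡Iᵗᶜ) (Iᵗᶜ-raises⇔ f e , λ { refl → Iᵗᶜ-subtree })
  where
  open IsSDecTree (IsSTamari.sdec T-tamari)
  open Ascent decreasing arity a<b find-b find-a ascent

  Z≡Iᵗᶜ : inv s Z f e ≡ Iᵗᶜ f e
  Z≡Iᵗᶜ = ≤-antisym (Z-least Iᵗᶜ (addPair⊆Iᵗᶜ n) (Iᵗᶜ-transitive n) e f 1≤e e<f f≤n)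
                    (Iᵗᶜ-least n (inv s Z) addPair⊆Z Z-transitive e f 1≤e e<f f≤n)

  Claim : ℕ → Set
  Claim k = (I f e < k ⇔ (f ≡ b × InSubtreeMinus0 T a e)) ×
            (f ≡ b → InSubtreeMinus0 T a e → k ≡ suc (I f e))
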